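{- Let $\alpha\in\{+,-\}$ and let $G$ be an almost strong $\alpha$-radial with root $r\in V(G)$. Then each block of $G$ over $r$ is an almost strong $\alpha$-radial with root $r$.
   Context: A bidirected graph $G$ is a finite graph (loops and parallel edges allowed) with maps $\partial_+,\partial_-:E(G)\to 2^{V(G)}$ such that for each edge $e$ with (possibly identical) ends $u,v$: $\partial_\alpha(e)\subseteq\{u,v\}$, $\partial_+(e)\cup\partial_-(e)=\{u,v\}$, and $\partial_+(e)\cap\partial_-(e)=\emptyset$ if $e$ is not a loop. If $u\in\partial_\alpha(e)$, the sign of $u$ over $e$ is $\alpha$; $-\alpha$ denotes the opposite sign. For a connected graph $G$ and a vertex $v$, the blocks of $G$ over $v$ are the induced subgraphs $G[V(C)\cup\{v\}]$ for the connected components $C$ of $G-v$. A walk is a sequence $W=(w_1,\dots,w_k)$, $k$ odd, with $w_i$ a vertex for odd $i$ and $w_i$ an edge joining $w_{i-1},w_{i+1}$ for even $i$; closed over $r$ if $w_1=w_k=r$; a trail has no repeated edge. $W$ is a diwalk if to each traversal of an edge $w_i$ one can assign signs to its end-occurrences equal to the signs of these vertices over $w_i$ (for a loop with one end $+$ and one end $-$, the two assigned signs are distinct), such that at every internal vertex term the signs assigned from the preceding and following edges are distinct. A ditrail is a diwalk that is a trail. For $k\ge3$ the sign of $w_1$ (resp. $w_k$) over $W$ is the sign assigned at $w_2$ (resp. $w_{k-1}$); $W$ is an $(\alpha,\beta)$-ditrail if these are $\alpha,\beta$; the trivial ditrail $(v)$ counts as both a $(+,-)$- and a $(-,+)$-ditrail.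 $G$ is an $\alpha$-radial with root $r$ if every $v$ has an $(\alpha,-\alpha)$-ditrail from $v$ to $r$. An $\alpha$-radial $G$ with root $r$ is almost strong if every $v\in V(G)\setminus\{r\}$ has a $(-\alpha,-\alpha)$-ditrail from $v$ to $r$, but $G$ has no $(-\alpha,-\alpha)$-ditrail closed over $r$. -}

module Defs where

open import Data.Nat using (ℕ)
open import Data.Fin using (Fin)
open import Data.Product using (Σ; _×_; _,_)
open import Data.Sum using (_⊎_)
open import Data.Empty using (⊥)
open import Data.Unit using (⊤)
open import Data.List using (List; []; _∷_)
open import Data.List.Relation.Unary.Unique.Propositional using (Unique)
open import Relation.Nullary using (¬_)
open import Relation.Binary.PropositionalEquality using (_≡_; _≢_)
open import Function.Bundles using (_↔_)

data Sign : Set where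
  plus minus : Sign

neg : Sign → Sign
neg plus  = minus
neg minus = plus

-- A bidirected graph, following the paper: each edge e has ends
-- end₁ e, end₂ e (possibly identical), and ∂ α e is the set of
-- vertices whose sign over e is α.
record BiGraph : Set₁ where
  field
    V E    : Set
    end₁   : E → V
    end₂   : E → V
    ∂      : Sign → E → V → Set
    ∂⊆     : ∀ α e v → ∂ α e v → (v ≡ end₁ e) ⊎ (v ≡ end₂ e)
    ∂cover : ∀ e v → (v ≡ end₁ e) ⊎ (v ≡ end₂ e) → ∂ plus e v ⊎ ∂ minus e v
    ∂disj  : ∀ e → end₁ e ≢ end₂ e → ∀ v → ∂ plus e v → ∂ minus e v → ⊥

Finite : BiGraph → Set
Finite G = Σ ℕ (λ n → V ↔ Fin n) × Σ ℕ (λ m → E ↔ Fin m)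
  where open BiGraph G

module _ (G : BiGraph) where
  open BiGraph G

  -- A traversal of edge e from x to y with signs s (at x) and t (at y)
  -- assigned to its end-occurrences, as in the definition of a diwalk.
  record Step (x : V) (e : E) (y : V) (s t : Sign) : Set where
    field
      joins   : (end₁ e ≡ x × end₂ e ≡ y) ⊎ (end₁ e ≡ y × end₂ e ≡ x)
      signˣ   : ∂ s e x
      signʸ   : ∂ t e y
      -- for a loop with one end + and one end -, the assigned signs differ
      loopMix : end₁ e ≡ end₂ e → ∂ plus e x → ∂ minus e x → s ≢ t

  -- Nontrivial diwalks in the induced subgraph G[S] (all vertices lie in S;
  -- hence every edge used has both ends in S), from x with sign s over the
  -- walk to y with sign t over the walk.  At each internal vertex the two
  -- assigned signs are distinct (the next edge starts with neg t).
  data DiWalk (S : V → Set) : V → Sign → V → Sign → Set where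
    one  : ∀ {x y e s t} → S x → S y → Step x e y s t → DiWalk S x s y t
    cons : ∀ {x y z e s t u} → S x → Step x e y s t →
           DiWalk S y (neg t) z u → DiWalk S x s z u

  edges : ∀ {S x s y t} → DiWalk S x s y t → List E
  edges (one {e = e} _ _ _)      = e ∷ []
  edges (cons {e = e} _ _ w)     = e ∷ edges w

  -- (α,β)-ditrail from x to y in G[S]; the trivial ditrail (x) counts
  -- exactly as a (+,-)- and a (-,+)-ditrail.
  DiTrail : (S : V → Set) → V → Sign → V → Sign → Set
  DiTrail S x α y β =
    (x ≡ y × S x × β ≡ neg α)
    ⊎ Σ (DiWalk S x α y β) (λ w → Unique (edges w))

  Radial : (S : V → Set) → Sign → V → Set
  Radial S α r = S r × (∀ v → S v → DiTrail S v α r (neg α))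

  AlmostStrong : (S : V → Set) → Sign → V → Set
  AlmostStrong S α r =
    Radial S α r
    × (∀ v → S v → v ≢ r → DiTrail S v (neg α) r (neg α))
    × ¬ DiTrail S r (neg α) r (neg α)

  All : V → Set
  All _ = ⊤

  data Walk (S : V → Set) : V → V → Set where
    nil  : ∀ {x} → S x → Walk S x x
    cons : ∀ {x y z} (e : E) → S x →
           (end₁ e ≡ x × end₂ e ≡ y) ⊎ (end₁ e ≡ y × end₂ e ≡ x) →
           Walk S y z → Walk S x z

  Minus : V → V → Set
  Minus r v = v ≢ r

  -- vertex set V(C) ∪ {r} of the block of G over r determined by the
  -- component C of G - r containing c (for c ≠ r)
  BlockOver : V → V → V → Set
  BlockOver r c v = (v ≡ r) ⊎ Walk (Minus r) c v

module Submission where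

-- Let B be the block of G over r containing c ≠ r.  Every
-- ditrail of G ending at r can be cut at its FIRST visit to r.  If it
-- arrives there with the sign β it must end with, the cut prefix is a
-- ditrail whose internal vertices avoid r; they are reached from the start
-- without passing r, so they lie in the component of G - r containing the
-- start, i.e. the prefix lives in B.  If it arrives with the other sign,
-- the remaining segment is a (β,β)-ditrail closed over r, which an almost
-- strong radial forbids (for β = -α).  Hence every (·,β)-ditrail of G from
-- a vertex of B to r yields one inside B (lemma `ditrail-into-block`),
-- which transfers the radial and almost-strong properties of G to B; and
-- a closed ditrail inside B is one of G, so B has none either.
-- The cut needs decidable equality of vertices, which follows from
-- finiteness of G.

open import Defs
open import Data.Empty using (⊥-elim)
open import Data.Fin using (_≟_)
open import Data.List using (List; []; _∷_)
open import Data.List.Relation.Unary.AllPairs using ([]; _∷_)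
open import Data.List.Relation.Unary.Unique.Propositional using (Unique)
open import Data.List.Relation.Binary.Sublist.Propositional using (_⊆_; []; _∷_; _∷ʳ_; minimum)
open import Data.List.Relation.Binary.Sublist.Propositional.Properties using (All-resp-⊆)
open import Data.Product using (Σ; _×_; _,_)
open import Data.Sum using (_⊎_; inj₁; inj₂)
open import Data.Unit using (tt)
open import Function.Properties.Inverse using (↔⇒↣)
open import Relation.Binary.Definitions using (DecidableEquality)
open import Relation.Binary.PropositionalEquality using (_≡_; _≢_; refl; sym; cong; subst)
open import Relation.Nullary using (¬_; yes; no)
open import Relation.Nullary.Decidable using (via-injection)

vertex-≟ : (G : BiGraph) → Finite G → DecidableEquality (BiGraph.V G)
vertex-≟ G ((_ , V↔Fin) , _) = via-injection (↔⇒↣ V↔Fin) _≟_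

Unique-⊆ : {A : Set} {xs ys : List A} → xs ⊆ ys → Unique ys → Unique xs
Unique-⊆ []             []         = []
Unique-⊆ (_ ∷ʳ xs⊆ys)   (_ ∷ u)    = Unique-⊆ xs⊆ys u
Unique-⊆ (refl ∷ xs⊆ys) (x∉ys ∷ u) = All-resp-⊆ xs⊆ys x∉ys ∷ Unique-⊆ xs⊆ys u

sign-dichotomy : (t β : Sign) → (t ≡ β) ⊎ (neg t ≡ β)
sign-dichotomy plus  plus  = inj₁ refl
sign-dichotomy plus  minus = inj₂ refl
sign-dichotomy minus plus  = inj₂ refl
sign-dichotomy minus minus = inj₁ refl

module _ (G : BiGraph) where
  open BiGraph G

  walk-snoc : ∀ {S x y z} (e : E) → Walk G S x y →
              (end₁ e ≡ y × end₂ e ≡ z) ⊎ (end₁ e ≡ z × end₂ e ≡ y) → S z →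
              Walk G S x z
  walk-snoc e (nil Sx)           joins Sz = cons e Sx joins (nil Sz)
  walk-snoc e (cons e′ Sx j′ w) joins Sz = cons e′ Sx j′ (walk-snoc e w joins Sz)

  walk-target : ∀ {S x y} → Walk G S x y → S y
  walk-target (nil Sx)       = Sx
  walk-target (cons _ _ _ w) = walk-target w

  module _ {S T : V → Set} (S⊆T : ∀ {v} → S v → T v) where

    diwalk-mono : ∀ {x s y t} → DiWalk G S x s y t → DiWalk G T x s y t
    diwalk-mono (one Sx Sy step)  = one (S⊆T Sx) (S⊆T Sy) step
    diwalk-mono (cons Sx step w) = cons (S⊆T Sx) step (diwalk-mono w)

    edges-mono : ∀ {x s y t} (w : DiWalk G S x s y t) →
                 edges G (diwalk-mono w) ≡ edges G w
    edges-mono (one _ _ _)           = refl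
    edges-mono (cons {e = e} _ _ w) = cong (e ∷_) (edges-mono w)

    ditrail-mono : ∀ {x s y t} → DiTrail G S x s y t → DiTrail G T x s y t
    ditrail-mono (inj₁ (x≡y , Sx , t≡-s)) = inj₁ (x≡y , S⊆T Sx , t≡-s)
    ditrail-mono (inj₂ (w , u)) = inj₂ (diwalk-mono w , subst Unique (sym (edges-mono w)) u)

  module _ (_≟ᵥ_ : DecidableEquality V) (r c : V) where

    private
      B : V → Set
      B = BlockOver G r c

    -- The walk
    -- from c is extended along the ditrail to witness that each newly visited
    -- vertex other than r lies in B.
    cut-at-root : ∀ {x s β} → ¬ DiTrail G (All G) r β r β →
                  Walk G (Minus G r) c x →
                  (w : DiWalk G (All G) x s r β) → Unique (edges G w) →
                  Σ (DiWalk G B x s r β) (λ w′ → edges G w′ ⊆ edges G w)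
    cut-at-root _ c⇝x (one _ _ step) _ = one (inj₂ c⇝x) (inj₁ refl) step , refl ∷ []
    cut-at-root {β = β} noClosed c⇝x (cons {y = y} {t = t} _ step rest) (_ ∷ u)
      with y ≟ᵥ r
    ... | no y≢r =
      let (w′ , w′⊆rest) = cut-at-root noClosed (walk-snoc _ c⇝x (Step.joins step) y≢r) rest u
      in cons (inj₂ c⇝x) step w′ , refl ∷ w′⊆rest
    ... | yes refl with sign-dichotomy t β
    ...   | inj₁ refl = one (inj₂ c⇝x) (inj₁ refl) step , refl ∷ minimum _
    ...   | inj₂ refl = ⊥-elim (noClosed (inj₂ (rest , u)))

    -- From r itself, a nontrivial trail would be closed with s = β unless
    -- β = -s, in which case the trivial ditrail (r) serves.
    ditrail-into-block : ∀ {v s β} → ¬ DiTrail G (All G) r β r β → B v →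
                         DiTrail G (All G) v s r β → DiTrail G B v s r β
    ditrail-into-block _ (inj₁ refl) (inj₁ (_ , _ , β≡-s)) = inj₁ (refl , inj₁ refl , β≡-s)
    ditrail-into-block {s = s} {β} noClosed (inj₁ refl) (inj₂ (w , u)) with sign-dichotomy s β
    ... | inj₁ refl  = ⊥-elim (noClosed (inj₂ (w , u)))
    ... | inj₂ -s≡β = inj₁ (refl , inj₁ refl , sym -s≡β)
    ditrail-into-block _ (inj₂ c⇝v) (inj₁ (v≡r , _ , _)) = ⊥-elim (walk-target c⇝v v≡r)
    ditrail-into-block noClosed (inj₂ c⇝v) (inj₂ (w , u)) =
      let (w′ , w′⊆w) = cut-at-root noClosed c⇝v w u
      in inj₂ (w′ , Unique-⊆ w′⊆w u)

-- Lemma 10.8: each block of an almost strong α-radial over its root r is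
-- again an almost strong α-radial with root r.
lemma10p8 : (G : BiGraph) → Finite G → (α : Sign) → (r : BiGraph.V G) →
    AlmostStrong G (All G) α r →
    (c : BiGraph.V G) → c ≢ r →
    AlmostStrong G (BlockOver G r c) α r
lemma10p8 G fin α r ((_ , radial) , strong , noClosed) c _ =
  (inj₁ refl , λ v v∈B → into-block v∈B (radial v tt)) ,
  (λ v v∈B v≢r → into-block v∈B (strong v tt v≢r)) ,
  (λ closed → noClosed (ditrail-mono G (λ _ → tt) closed))
  where
  into-block : ∀ {v s} → BlockOver G r c v →
               DiTrail G (All G) v s r (neg α) → DiTrail G (BlockOver G r c) v s r (neg α)
  into-block = ditrail-into-block G (vertex-≟ G fin) r c noClosed
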